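{- Let $\Phi$ be the translation from classical formulas (over $\{\wedge,\vee,\neg\}$ and variables $PV$) to formulas over $\{\wedge,\vee,{\sim}\}$ defined by $\Phi(p)=p$ for $p\in PV$, $\Phi(A\circ B)=\Phi(A)\circ\Phi(B)$ for $\circ\in\{\wedge,\vee\}$, and $\Phi(\neg A)={\sim}{\sim}\Phi(A)$. Then for all classical formulas $A,B$: \[A\vDash_C B\iff \Phi(A)\vDash_{\mathbf{CNL_4^2}}\Phi(B)\iff \Phi(A)\vDash_{\mathbf{CNLL_4^2}}\Phi(B).\]
   Context: Let $\mathscr U=\{\mathbf T,\mathbf{TU},\mathbf{FU},\mathbf F\}$. The lattice $4\mathcal Q$ orders $\mathscr U$ with $\mathbf T$ top, $\mathbf F$ bottom and $\mathbf{TU},\mathbf{FU}$ incomparable; the lattice $4\mathcal{LQ}$ is the chain $\mathbf{FU}<\mathbf F<\mathbf{TU}<\mathbf T$. Let $f_{\sim}:\mathscr U\to\mathscr U$ be $\mathbf T\mapsto\mathbf{TU}$, $\mathbf{TU}\mapsto\mathbf F$, $\mathbf F\mapsto\mathbf{FU}$, $\mathbf{FU}\mapsto\mathbf T$. The designated set is $\mathcal D=\{\mathbf T,\mathbf{TU}\}$. Formulas over $\{\wedge,\vee,{\sim}\}$ are built from a countable set $PV$ of variables. A $\mathbf{CNL_4^2}$-valuation is a map $v:PV\to\mathscr U$ extended to all formulas by interpreting $\wedge,\vee$ as meet and join of $4\mathcal Q$ and ${\sim}$ as $f_{\sim}$; a $\mathbf{CNLL_4^2}$-valuation is defined likewise using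 meet and join of $4\mathcal{LQ}$ and the same $f_{\sim}$. $A\vDash_{\mathbf{CNL_4^2}}B$ means: for every $\mathbf{CNL_4^2}$-valuation $v$, $v(A)\in\mathcal D$ implies $v(B)\in\mathcal D$; $\vDash_{\mathbf{CNLL_4^2}}$ is defined analogously. $A\vDash_C B$ denotes classical consequence, taken with respect to the four-element Boolean algebra on the lattice $4\mathcal Q$ (complement swapping $\mathbf T\leftrightarrow\mathbf F$ and $\mathbf{TU}\leftrightarrow\mathbf{FU}$): for every map $v:PV\to\mathscr U$ extended via meet, join and complement, $v(A)=\mathbf T$ implies $v(B)=\mathbf T$ (this coincides with ordinary classical propositional consequence). -}

module Defs where

open import Data.Nat using (ℕ)
open import Relation.Binary.PropositionalEquality using (_≡_)

data U : Set where
  T TU FU F : U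

PV : Set
PV = ℕ

data CFm : Set where
  var  : PV → CFm
  _∧c_ : CFm → CFm → CFm
  _∨c_ : CFm → CFm → CFm
  ¬c_  : CFm → CFm

data NFm : Set where
  var  : PV → NFm
  _∧n_ : NFm → NFm → NFm
  _∨n_ : NFm → NFm → NFm
  ∼_   : NFm → NFm

-- Lattice 4Q: T top, F bottom, TU and FU incomparable
meetQ : U → U → U
meetQ T y = y
meetQ F y = F
meetQ TU T = TU
meetQ TU TU = TU
meetQ TU FU = F
meetQ TU F = F
meetQ FU T = FU
meetQ FU TU = F
meetQ FU FU = FU
meetQ FU F = F

joinQ : U → U → U
joinQ T y = T
joinQ F y = y
joinQ TU T = T
joinQ TU TU = TU
joinQ TU FU = T
joinQ TU F = TU
joinQ FU T = T
joinQ FU TU = T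
joinQ FU FU = FU
joinQ FU F = FU

-- Lattice 4LQ: the chain FU < F < TU < T, encoded by rank
rank : U → ℕ
rank FU = 0
rank F  = 1
rank TU = 2
rank T  = 3

meetLQ : U → U → U
meetLQ FU y = FU
meetLQ x FU = FU
meetLQ F y = F
meetLQ x F = F
meetLQ TU y = TU
meetLQ x TU = TU
meetLQ T T = T

joinLQ : U → U → U
joinLQ T y = T
joinLQ x T = T
joinLQ TU y = TU
joinLQ x TU = TU
joinLQ F y = F
joinLQ x F = F
joinLQ FU FU = FU

f∼ : U → U
f∼ T  = TU
f∼ TU = F
f∼ F  = FU
f∼ FU = T

compl : U → U
compl T  = F
compl F  = T
compl TU = FU
compl FU = TU

data Designated : U → Set where
  desT  : Designated T
  desTU : Designated TU

evalCNL : (PV → U) → NFm → U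
evalCNL v (var p) = v p
evalCNL v (A ∧n B) = meetQ (evalCNL v A) (evalCNL v B)
evalCNL v (A ∨n B) = joinQ (evalCNL v A) (evalCNL v B)
evalCNL v (∼ A) = f∼ (evalCNL v A)

evalCNLL : (PV → U) → NFm → U
evalCNLL v (var p) = v p
evalCNLL v (A ∧n B) = meetLQ (evalCNLL v A) (evalCNLL v B)
evalCNLL v (A ∨n B) = joinLQ (evalCNLL v A) (evalCNLL v B)
evalCNLL v (∼ A) = f∼ (evalCNLL v A)

evalC : (PV → U) → CFm → U
evalC v (var p) = v p
evalC v (A ∧c B) = meetQ (evalC v A) (evalC v B)
evalC v (A ∨c B) = joinQ (evalC v A) (evalC v B)
evalC v (¬c A) = compl (evalC v A)

_⊨C_ : CFm → CFm → Set
A ⊨C B = (v : PV → U) → evalC v A ≡ T → evalC v B ≡ T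

_⊨CNL_ : NFm → NFm → Set
A ⊨CNL B = (v : PV → U) → Designated (evalCNL v A) → Designated (evalCNL v B)

_⊨CNLL_ : NFm → NFm → Set
A ⊨CNLL B = (v : PV → U) → Designated (evalCNLL v A) → Designated (evalCNLL v B)

Φ : CFm → NFm
Φ (var p) = var p
Φ (A ∧c B) = Φ A ∧n Φ B
Φ (A ∨c B) = Φ A ∨n Φ B
Φ (¬c A) = ∼ (∼ (Φ A))

{-# OPTIONS --safe #-}
module Submission where

-- Read 4Q as the Boolean algebra 2 × 2 via (π₁, π₂), with T = (1,1), TU = (1,0),
-- FU = (0,1), F = (0,0).  Then f∼ ∘ f∼ is the complement, and a value is designated
-- iff its first coordinate is 1.  π₁ is monotone for both 4Q and 4LQ (where the
-- chain FU < F < TU < T puts the designated values on top), so in either semantics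
-- π₁ is a homomorphism to 2 and the designation of Φ A under v is the two-valued
-- truth of A under π₁ ∘ v.  Both four-valued consequences therefore coincide with
-- two-valued consequence, and so does ⊨C, since x ≡ T iff π₁ x and π₂ x are 1 and
-- both coordinate projections are Boolean homomorphisms.

open import Defs
open import Data.Bool using (Bool; true; false; _∧_; _∨_; not)
open import Data.Product using (_×_; _,_)
open import Function using (_∘_)
open import Function.Bundles using (_⇔_; mk⇔)
open import Function.Construct.Composition using (_⇔-∘_)
open import Function.Construct.Symmetry using (⇔-sym)
open import Relation.Binary.PropositionalEquality
  using (_≡_; _≗_; refl; sym; trans; cong; cong₂)

π₁ π₂ : U → Bool
π₁ T  = true
π₁ TU = true
π₁ FU = false
π₁ F  = false

π₂ T  = true
π₂ TU = false
π₂ FU = true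
π₂ F  = false

Designated⇒π₁ : ∀ {x} → Designated x → π₁ x ≡ true
Designated⇒π₁ desT  = refl
Designated⇒π₁ desTU = refl

π₁⇒Designated : ∀ x → π₁ x ≡ true → Designated x
π₁⇒Designated T  _ = desT
π₁⇒Designated TU _ = desTU

π₁-π₂⇒≡T : ∀ x → π₁ x ≡ true → π₂ x ≡ true → x ≡ T
π₁-π₂⇒≡T T _ _ = refl

≡T⇒π₁ : ∀ {x} → x ≡ T → π₁ x ≡ true
≡T⇒π₁ refl = refl

≡T⇒π₂ : ∀ {x} → x ≡ T → π₂ x ≡ true
≡T⇒π₂ refl = refl

embed : Bool → U
embed true  = T
embed false = F

π₁∘embed : ∀ b → π₁ (embed b) ≡ b
π₁∘embed true  = refl
π₁∘embed false = refl

π₂∘embed : ∀ b → π₂ (embed b) ≡ b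
π₂∘embed true  = refl
π₂∘embed false = refl

π₁-meetQ : ∀ x y → π₁ (meetQ x y) ≡ π₁ x ∧ π₁ y
π₁-meetQ T  y  = refl
π₁-meetQ F  y  = refl
π₁-meetQ TU T  = refl
π₁-meetQ TU TU = refl
π₁-meetQ TU FU = refl
π₁-meetQ TU F  = refl
π₁-meetQ FU T  = refl
π₁-meetQ FU TU = refl
π₁-meetQ FU FU = refl
π₁-meetQ FU F  = refl

π₁-joinQ : ∀ x y → π₁ (joinQ x y) ≡ π₁ x ∨ π₁ y
π₁-joinQ T  y  = refl
π₁-joinQ F  y  = refl
π₁-joinQ TU T  = refl
π₁-joinQ TU TU = refl
π₁-joinQ TU FU = refl
π₁-joinQ TU F  = refl
π₁-joinQ FU T  = refl
π₁-joinQ FU TU = refl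
π₁-joinQ FU FU = refl
π₁-joinQ FU F  = refl

π₂-meetQ : ∀ x y → π₂ (meetQ x y) ≡ π₂ x ∧ π₂ y
π₂-meetQ T  y  = refl
π₂-meetQ F  y  = refl
π₂-meetQ TU T  = refl
π₂-meetQ TU TU = refl
π₂-meetQ TU FU = refl
π₂-meetQ TU F  = refl
π₂-meetQ FU T  = refl
π₂-meetQ FU TU = refl
π₂-meetQ FU FU = refl
π₂-meetQ FU F  = refl

π₂-joinQ : ∀ x y → π₂ (joinQ x y) ≡ π₂ x ∨ π₂ y
π₂-joinQ T  y  = refl
π₂-joinQ F  y  = refl
π₂-joinQ TU T  = refl
π₂-joinQ TU TU = refl
π₂-joinQ TU FU = refl
π₂-joinQ TU F  = refl
π₂-joinQ FU T  = refl
π₂-joinQ FU TU = refl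
π₂-joinQ FU FU = refl
π₂-joinQ FU F  = refl

π₁-meetLQ : ∀ x y → π₁ (meetLQ x y) ≡ π₁ x ∧ π₁ y
π₁-meetLQ T  T  = refl
π₁-meetLQ T  TU = refl
π₁-meetLQ T  FU = refl
π₁-meetLQ T  F  = refl
π₁-meetLQ TU T  = refl
π₁-meetLQ TU TU = refl
π₁-meetLQ TU FU = refl
π₁-meetLQ TU F  = refl
π₁-meetLQ FU y  = refl
π₁-meetLQ F  T  = refl
π₁-meetLQ F  TU = refl
π₁-meetLQ F  FU = refl
π₁-meetLQ F  F  = refl

π₁-joinLQ : ∀ x y → π₁ (joinLQ x y) ≡ π₁ x ∨ π₁ y
π₁-joinLQ T  y  = refl
π₁-joinLQ TU T  = refl
π₁-joinLQ TU TU = refl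
π₁-joinLQ TU FU = refl
π₁-joinLQ TU F  = refl
π₁-joinLQ FU T  = refl
π₁-joinLQ FU TU = refl
π₁-joinLQ FU FU = refl
π₁-joinLQ FU F  = refl
π₁-joinLQ F  T  = refl
π₁-joinLQ F  TU = refl
π₁-joinLQ F  FU = refl
π₁-joinLQ F  F  = refl

π₁-compl : ∀ x → π₁ (compl x) ≡ not (π₁ x)
π₁-compl T  = refl
π₁-compl TU = refl
π₁-compl FU = refl
π₁-compl F  = refl

π₂-compl : ∀ x → π₂ (compl x) ≡ not (π₂ x)
π₂-compl T  = refl
π₂-compl TU = refl
π₂-compl FU = refl
π₂-compl F  = refl

f∼∘f∼≗compl : ∀ x → f∼ (f∼ x) ≡ compl x
f∼∘f∼≗compl T  = refl
f∼∘f∼≗compl TU = refl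
f∼∘f∼≗compl FU = refl
f∼∘f∼≗compl F  = refl

evalB : (PV → Bool) → CFm → Bool
evalB w (var p)  = w p
evalB w (A ∧c B) = evalB w A ∧ evalB w B
evalB w (A ∨c B) = evalB w A ∨ evalB w B
evalB w (¬c A)   = not (evalB w A)

_⊨B_ : CFm → CFm → Set
A ⊨B B = (w : PV → Bool) → evalB w A ≡ true → evalB w B ≡ true

evalB-cong : ∀ {w w′} → w ≗ w′ → ∀ A → evalB w A ≡ evalB w′ A
evalB-cong w≗w′ (var p)  = w≗w′ p
evalB-cong w≗w′ (A ∧c B) = cong₂ _∧_ (evalB-cong w≗w′ A) (evalB-cong w≗w′ B)
evalB-cong w≗w′ (A ∨c B) = cong₂ _∨_ (evalB-cong w≗w′ A) (evalB-cong w≗w′ B)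
evalB-cong w≗w′ (¬c A)   = cong not (evalB-cong w≗w′ A)

module BooleanHomomorphism
  (h : U → Bool)
  (h-meetQ : ∀ x y → h (meetQ x y) ≡ h x ∧ h y)
  (h-joinQ : ∀ x y → h (joinQ x y) ≡ h x ∨ h y)
  (h-compl : ∀ x → h (compl x) ≡ not (h x))
  where

  h-evalC : ∀ v A → h (evalC v A) ≡ evalB (h ∘ v) A
  h-evalC v (var p)  = refl
  h-evalC v (A ∧c B) = trans (h-meetQ _ _) (cong₂ _∧_ (h-evalC v A) (h-evalC v B))
  h-evalC v (A ∨c B) = trans (h-joinQ _ _) (cong₂ _∨_ (h-evalC v A) (h-evalC v B))
  h-evalC v (¬c A)   = trans (h-compl _) (cong not (h-evalC v A))

open BooleanHomomorphism π₁ π₁-meetQ π₁-joinQ π₁-compl renaming (h-evalC to π₁-evalC)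
open BooleanHomomorphism π₂ π₂-meetQ π₂-joinQ π₂-compl renaming (h-evalC to π₂-evalC)

π₁-evalCNL-Φ : ∀ v A → π₁ (evalCNL v (Φ A)) ≡ evalB (π₁ ∘ v) A
π₁-evalCNL-Φ v (var p)  = refl
π₁-evalCNL-Φ v (A ∧c B) =
  trans (π₁-meetQ (evalCNL v (Φ A)) (evalCNL v (Φ B)))
    (cong₂ _∧_ (π₁-evalCNL-Φ v A) (π₁-evalCNL-Φ v B))
π₁-evalCNL-Φ v (A ∨c B) =
  trans (π₁-joinQ (evalCNL v (Φ A)) (evalCNL v (Φ B)))
    (cong₂ _∨_ (π₁-evalCNL-Φ v A) (π₁-evalCNL-Φ v B))
π₁-evalCNL-Φ v (¬c A)   = trans (cong π₁ (f∼∘f∼≗compl _))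
  (trans (π₁-compl _) (cong not (π₁-evalCNL-Φ v A)))

π₁-evalCNLL-Φ : ∀ v A → π₁ (evalCNLL v (Φ A)) ≡ evalB (π₁ ∘ v) A
π₁-evalCNLL-Φ v (var p)  = refl
π₁-evalCNLL-Φ v (A ∧c B) =
  trans (π₁-meetLQ (evalCNLL v (Φ A)) (evalCNLL v (Φ B)))
    (cong₂ _∧_ (π₁-evalCNLL-Φ v A) (π₁-evalCNLL-Φ v B))
π₁-evalCNLL-Φ v (A ∨c B) =
  trans (π₁-joinLQ (evalCNLL v (Φ A)) (evalCNLL v (Φ B)))
    (cong₂ _∨_ (π₁-evalCNLL-Φ v A) (π₁-evalCNLL-Φ v B))
π₁-evalCNLL-Φ v (¬c A)   = trans (cong π₁ (f∼∘f∼≗compl _))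
  (trans (π₁-compl _) (cong not (π₁-evalCNLL-Φ v A)))

designation-preserving⇔⊨B :
  (eval : (PV → U) → NFm → U) →
  (∀ v A → π₁ (eval v (Φ A)) ≡ evalB (π₁ ∘ v) A) →
  ∀ A B →
  ((v : PV → U) → Designated (eval v (Φ A)) → Designated (eval v (Φ B))) ⇔ (A ⊨B B)
designation-preserving⇔⊨B eval π₁-eval-Φ A B = mk⇔ to from
  where
  Preserves : Set
  Preserves = (v : PV → U) → Designated (eval v (Φ A)) → Designated (eval v (Φ B))

  π₁-eval-Φ-embed : ∀ w C → π₁ (eval (embed ∘ w) (Φ C)) ≡ evalB w C
  π₁-eval-Φ-embed w C = trans (π₁-eval-Φ (embed ∘ w) C) (evalB-cong (π₁∘embed ∘ w) C)

  to : Preserves → A ⊨B B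
  to preserves w A-true = trans (sym (π₁-eval-Φ-embed w B)) (Designated⇒π₁
    (preserves (embed ∘ w) (π₁⇒Designated _ (trans (π₁-eval-Φ-embed w A) A-true))))

  from : A ⊨B B → Preserves
  from A⊨B v A-des = π₁⇒Designated _ (trans (π₁-eval-Φ v B)
    (A⊨B (π₁ ∘ v) (trans (sym (π₁-eval-Φ v A)) (Designated⇒π₁ A-des))))

⊨C⇔⊨B : ∀ A B → (A ⊨C B) ⇔ (A ⊨B B)
⊨C⇔⊨B A B = mk⇔ to from
  where
  evalC≡T : ∀ v C → evalB (π₁ ∘ v) C ≡ true → evalB (π₂ ∘ v) C ≡ true → evalC v C ≡ T
  evalC≡T v C true₁ true₂ =
    π₁-π₂⇒≡T _ (trans (π₁-evalC v C) true₁) (trans (π₂-evalC v C) true₂)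

  to : A ⊨C B → A ⊨B B
  to A⊨B w A-true = trans (sym (trans (π₁-evalC v B) (evalB-cong (π₁∘embed ∘ w) B)))
    (≡T⇒π₁ (A⊨B v (evalC≡T v A (trans (evalB-cong (π₁∘embed ∘ w) A) A-true)
                                (trans (evalB-cong (π₂∘embed ∘ w) A) A-true))))
    where
    v : PV → U
    v = embed ∘ w

  from : A ⊨B B → A ⊨C B
  from A⊨B v A≡T = evalC≡T v B
    (A⊨B (π₁ ∘ v) (trans (sym (π₁-evalC v A)) (≡T⇒π₁ A≡T)))
    (A⊨B (π₂ ∘ v) (trans (sym (π₂-evalC v A)) (≡T⇒π₂ A≡T)))

mainTheorem3 : (A B : CFm) →
    ((A ⊨C B) ⇔ (Φ A ⊨CNL Φ B)) × ((Φ A ⊨CNL Φ B) ⇔ (Φ A ⊨CNLL Φ B))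
mainTheorem3 A B = ⇔-sym CNL⇔B ⇔-∘ ⊨C⇔⊨B A B , ⇔-sym CNLL⇔B ⇔-∘ CNL⇔B
  where
  CNL⇔B : (Φ A ⊨CNL Φ B) ⇔ (A ⊨B B)
  CNL⇔B = designation-preserving⇔⊨B evalCNL π₁-evalCNL-Φ A B

  CNLL⇔B : (Φ A ⊨CNLL Φ B) ⇔ (A ⊨B B)
  CNLL⇔B = designation-preserving⇔⊨B evalCNLL π₁-evalCNLL-Φ A B
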